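{- Let $T$ be a standard shifted $k$-ribbon tableau with $n$ ribbons, and let $T'\in\mathrm{Mark}(T)$. Then $\mathrm{Spike}(\mathrm{Des}(T'))\supseteq\mathrm{Peak}(\mathrm{Des}(T))$.
   Context: Standard tableaux. Diagrams are drawn in French convention. A standard shifted $k$-ribbon tableau of shape $\lambda$ ($\lambda$ a strict partition identified with its shifted diagram) is a chain $\lambda^{(0)}\subset\cdots\subset\lambda^{(n)}=\lambda$ such that $\lambda^{(0)}$ has no removable $k$-ribbon and each $\lambda^{(i)}\setminus\lambda^{(i-1)}$ is a removable $k$-ribbon, labelled $i$. Here a $k$-ribbon is a set of $k$ cells forming a single or double ribbon. Each ribbon has a head cell: its cell of largest diagonal value $c-r+1$, or for a double ribbon that of its larger piece. Reading word and descents. The reading word of $T$ lists the head labels row by row from the top row to the bottom row, left to right within a row. $\mathrm{Des}(T)=\{i\in[n-1]: i+1 \text{ appears to the left of } i\}$. Marked tableaux. $\mathrm{Mark}(T)$ is the set of marked versions $T'$ of $T$: for each subset $M\subseteq[n]$, the labels $i\in M$ are replaced by $i'$. To define $\mathrm{Des}(T')$, form the word consisting of the marked labels in reverse reading-word order, followed by the unmarked labels in reading-word order, all marks being erased. Then $\mathrm{Des}(T')$ is the set of $i\in[n-1]$ such that $i+1$ appears to the left of $i$ in this word. Peaks and spikes. For $D\subseteq[n-1]$: - $\mathrm{Peak}(D)=\{i\ge2: i\in D,\ i-1\notin D\}$; - $\mathrm{Spike}(D)=\{i\ge 2:\text{exactly one of } i,\ i-1 \text{ lies in } D\}$. -}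

module Defs where

open import Level using (0ℓ)
open import Data.Bool using (Bool; true; false; not)
open import Data.Nat using (ℕ; zero; suc; pred; _+_; _∸_; _≤_; _<_; _>_; _≟_)
open import Data.List using (List; []; _∷_; _++_; length; upTo; map; concatMap; reverse; filterᵇ)
open import Data.Nat.ListAction using (sum)
open import Data.List.Relation.Unary.All using (All)
open import Data.List.Relation.Unary.Linked using (Linked)
open import Data.Product using (Σ; ∃; _×_; _,_; proj₁; proj₂)
open import Data.Sum using (_⊎_)
open import Data.Empty using (⊥)
open import Relation.Nullary using (¬_; Dec; yes; no)
open import Relation.Nullary.Decidable using (⌊_⌋)
open import Relation.Binary.PropositionalEquality using (_≡_)
import Data.Product.Properties as ×P
open import Function.Bundles using (_⇔_)

-- Cells and shifted diagrams
-- A cell is (r , c) = (row , column), 1-indexed.  French convention: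
-- row 1 is the bottom row, so the "top row" is the one with largest r.

Cell : Set
Cell = ℕ × ℕ

row col : Cell → ℕ
row = proj₁
col = proj₂

_≟c_ : (x y : Cell) → Dec (x ≡ y)
_≟c_ = ×P.≡-dec _≟_ _≟_

diag : Cell → ℕ
diag (r , c) = suc c ∸ r

IsStrictPartition : List ℕ → Set
IsStrictPartition p = All (λ x → 1 ≤ x) p × Linked _>_ p

nthPart : List ℕ → ℕ → ℕ
nthPart []       _       = 0
nthPart (x ∷ xs) zero    = x
nthPart (x ∷ xs) (suc j) = nthPart xs j

-- part p r = p_r  (1-indexed; 0 for r = 0 or r > length p)
part : List ℕ → ℕ → ℕ
part p zero    = 0
part p (suc j) = nthPart p j

size : List ℕ → ℕ
size = sum

InShifted : List ℕ → Cell → Set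
InShifted p (r , c) = 1 ≤ r × r ≤ c × c < r + part p r

_⊆sh_ : List ℕ → List ℕ → Set
m ⊆sh p = ∀ x → InShifted m x → InShifted p x

InSkew : List ℕ → List ℕ → Cell → Set
InSkew p m x = InShifted p x × ¬ InShifted m x

Adjacent : Cell → Cell → Set
Adjacent (r , c) (r' , c') =
  (r ≡ r' × (suc c ≡ c' ⊎ suc c' ≡ c)) ⊎ (c ≡ c' × (suc r ≡ r' ⊎ suc r' ≡ r))

data Path (S : Cell → Set) : Cell → Cell → Set where
  here : ∀ {x} → Path S x x
  step : ∀ {x y z} → Adjacent x y → S y → Path S y z → Path S x z

Connected : (Cell → Set) → Set
Connected S = ∀ x y → S x → S y → Path S x y

IsRibbon : (Cell → Set) → Set
IsRibbon S =
  (∃ λ x → S x) × Connected S ×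
  (∀ x y → S x → S y → diag x ≡ diag y → x ≡ y)

IsDoubleRibbon : (Cell → Set) → Set₁
IsDoubleRibbon S =
  Σ (Cell → Set) λ A → Σ (Cell → Set) λ B →
    (∀ x → S x ⇔ (A x ⊎ B x)) ×
    (∀ x → A x → B x → ⊥) ×
    IsRibbon A × IsRibbon B ×
    (∃ λ d → A (d , d)) × (∃ λ d → B (d , d))

RemovableRibbon : ℕ → List ℕ → List ℕ → Set₁
RemovableRibbon k p m =
  IsStrictPartition m × m ⊆sh p × size p ≡ size m + k ×
  (IsRibbon (InSkew p m) ⊎ IsDoubleRibbon (InSkew p m))

IsHead : (Cell → Set) → Cell → Set
IsHead S h = S h × (∀ x → S x → diag x ≤ diag h)

-- Standard shifted k-ribbon tableaux of shape sh with n ribbons.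
-- shape i = λ^(i) (only 0 ≤ i ≤ n matters); the ribbon labelled i is
-- λ^(i) / λ^(i-1), with head cell head i.

record SSRT (k n : ℕ) (sh : List ℕ) : Set₁ where
  field
    shape      : ℕ → List ℕ
    head       : ℕ → Cell
    shape-top  : shape n ≡ sh
    shape-sp   : ∀ i → i ≤ n → IsStrictPartition (shape i)
    core       : ¬ (∃ λ m → RemovableRibbon k (shape 0) m)
    ribbon     : ∀ i → 1 ≤ i → i ≤ n → RemovableRibbon k (shape i) (shape (pred i))
    head-spec  : ∀ i → 1 ≤ i → i ≤ n → IsHead (InSkew (shape i) (shape (pred i))) (head i)
open SSRT public

labels : ℕ → List ℕ
labels n = map suc (upTo n)

readingWord : ∀ {k n sh} → SSRT k n sh → List ℕ
readingWord {k} {n} {sh} T =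
  concatMap (λ r →
    concatMap (λ c → filterᵇ (λ i → ⌊ head T i ≟c (r , c) ⌋) (labels n))
              (labels (length sh + part sh 1)))
    (reverse (labels (length sh)))

LeftOf : List ℕ → ℕ → ℕ → Set
LeftOf w a b = ∃ λ xs → ∃ λ ys → ∃ λ zs → w ≡ xs ++ a ∷ ys ++ b ∷ zs

DesW : ℕ → List ℕ → ℕ → Set
DesW n w i = 1 ≤ i × i < n × LeftOf w (suc i) i

Des : ∀ {k n sh} → SSRT k n sh → ℕ → Set
Des {n = n} T = DesW n (readingWord T)

-- marked version T' of T given by M ⊆ [n] (M i = true iff i is marked):
-- marked labels in reverse reading order, then unmarked labels in
-- reading order
markedWord : ∀ {k n sh} → SSRT k n sh → (ℕ → Bool) → List ℕ
markedWord T M = reverse (filterᵇ M (readingWord T)) ++ filterᵇ (λ i → not (M i)) (readingWord T)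

DesMarked : ∀ {k n sh} → SSRT k n sh → (ℕ → Bool) → ℕ → Set
DesMarked {n = n} T M = DesW n (markedWord T M)

Peak : (ℕ → Set) → ℕ → Set
Peak D i = 2 ≤ i × D i × ¬ D (pred i)

Spike : (ℕ → Set) → ℕ → Set
Spike D i = 2 ≤ i × ((D i × ¬ D (pred i)) ⊎ (¬ D i × D (pred i)))

module Submission where

-- The statement is about words.  Let w have no repeated letter and
-- contain 1 .. n; its marked word w' lists the marked letters of w in
-- reverse order, then the unmarked ones in order.  At a peak i of Des(w)
-- the letter i+1 is left of i, but i is not left of i-1.  If i is
-- unmarked, i+1 stays left of i and i still does not precede i-1, so
-- i ∈ Des(w'), i-1 ∉ Des(w').  If i is marked, i+1 left of i in w' would
-- mean i left of i+1 in w, impossible; but i now precedes i-1.  So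
-- i-1 ∈ Des(w'), i ∉ Des(w'), and i is a spike either way.

open import Defs
open import Data.Bool using (Bool; true; false; not; T)
open import Data.Bool.Properties using (T?)
open import Data.Unit using (tt)
open import Data.Nat using (ℕ; zero; suc; _+_; _≤_; _<_; _>_; z≤n; s≤s)
open import Data.Nat.Properties
  using (≤-trans; ≤-refl; <⇒≤; ≤-<-trans; <-≤-trans; +-mono-≤; +-identityʳ; +-cancelˡ-<;
         ≤-pred; 1+n≢n; suc-injective; m≤n⇒m<n∨m≡n)
open import Data.List using (List; []; _∷_; _++_; reverse; filter; filterᵇ; concatMap; length; [_])
open import Data.List.Properties using (++-assoc; unfold-reverse; reverse-involutive; filter-accept)
open import Data.List.Membership.Propositional using (_∈_; find; lose)
open import Data.List.Membership.Propositional.Properties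
  using (∈-∃++; ∈-++⁺ʳ; ∈-++⁻; ∈-filter⁺; ∈-filter⁻; ∈-map⁺; ∈-upTo⁺; ∈-concatMap⁺; ∈-concatMap⁻)
import Data.List.Relation.Unary.All as All
open import Data.List.Relation.Unary.AllPairs using ([]; _∷_)
open import Data.List.Relation.Unary.Any using (here; there; satisfied)
open import Data.List.Relation.Unary.Any.Properties using (reverse⁺; reverse⁻)
open import Data.List.Relation.Unary.Linked using (Linked; []; _∷_)
open import Data.List.Relation.Unary.Unique.Propositional using (Unique)
import Data.List.Relation.Unary.Unique.Propositional.Properties as Unique
open import Relation.Binary.PropositionalEquality using (_≡_; _≢_; refl; sym; trans; cong; subst; setoid)
open import Data.List.Relation.Binary.Permutation.Setoid.Properties (setoid ℕ) using (Unique-resp-↭; ↭-reverse)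
open import Data.List.Relation.Binary.Permutation.Setoid (setoid ℕ) using (↭-sym)
open import Data.Product using (_×_; _,_; proj₁; proj₂)
open import Data.Sum using (_⊎_; inj₁; inj₂)
open import Data.Empty using (⊥; ⊥-elim)
open import Function using (_∘_)
open import Relation.Nullary using (¬_; yes; no)
open import Relation.Nullary.Decidable using (⌊_⌋; toWitness; fromWitness)
open import Relation.Unary using (Pred; Decidable)

LeftOf-∈ : ∀ {w a b} → LeftOf w a b → a ∈ w × b ∈ w
LeftOf-∈ (xs , ys , zs , refl) =
  ∈-++⁺ʳ xs (here refl) , ∈-++⁺ʳ xs (there (∈-++⁺ʳ ys (here refl)))

LeftOf-head : ∀ {w a b} → b ∈ w → LeftOf (a ∷ w) a b
LeftOf-head b∈w with us , vs , refl ← ∈-∃++ b∈w = [] , us , vs , refl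

LeftOf-∷ : ∀ {x w a b} → LeftOf w a b → LeftOf (x ∷ w) a b
LeftOf-∷ {x} (xs , ys , zs , refl) = x ∷ xs , ys , zs , refl

LeftOf-∷⁻ : ∀ {x w a b} → LeftOf (x ∷ w) a b → (x ≡ a × b ∈ w) ⊎ LeftOf w a b
LeftOf-∷⁻ ([] , ys , zs , refl) = inj₁ (refl , ∈-++⁺ʳ ys (here refl))
LeftOf-∷⁻ (_ ∷ xs , ys , zs , refl) = inj₂ (xs , ys , zs , refl)

LeftOf-[] : ∀ {a b} → ¬ LeftOf [] a b
LeftOf-[] ([] , _ , _ , ())
LeftOf-[] (_ ∷ _ , _ , _ , ())

LeftOf-++ : ∀ {xs ys a b} → a ∈ xs → b ∈ ys → LeftOf (xs ++ ys) a b
LeftOf-++ {ys = ys} a∈xs b∈ys with us , vs , refl ← ∈-∃++ a∈xs | ps , qs , refl ← ∈-∃++ b∈ys =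
  us , vs ++ ps , qs ,
  trans (++-assoc us (_ ∷ vs) _) (cong (λ z → us ++ _ ∷ z) (sym (++-assoc vs ps _)))

LeftOf-++ʳ : ∀ xs {ys a b} → LeftOf ys a b → LeftOf (xs ++ ys) a b
LeftOf-++ʳ []       ab = ab
LeftOf-++ʳ (x ∷ xs) ab = LeftOf-∷ (LeftOf-++ʳ xs ab)

LeftOf-++ˡ : ∀ {xs} ys {a b} → LeftOf xs a b → LeftOf (xs ++ ys) a b
LeftOf-++ˡ ys (us , vs , ws , refl) =
  us , vs , ws ++ ys , trans (++-assoc us _ ys) (cong (λ z → us ++ _ ∷ z) (++-assoc vs _ ys))

LeftOf-++⁻ : ∀ xs {ys a b} → LeftOf (xs ++ ys) a b →
  LeftOf xs a b ⊎ ((a ∈ xs × b ∈ ys) ⊎ LeftOf ys a b)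
LeftOf-++⁻ []       ab = inj₂ (inj₂ ab)
LeftOf-++⁻ (x ∷ xs) ab with LeftOf-∷⁻ ab
... | inj₁ (refl , b∈) with ∈-++⁻ xs b∈
...   | inj₁ b∈xs = inj₁ (LeftOf-head b∈xs)
...   | inj₂ b∈ys = inj₂ (inj₁ (here refl , b∈ys))
LeftOf-++⁻ (x ∷ xs) ab | inj₂ ab′ with LeftOf-++⁻ xs ab′
... | inj₁ l                 = inj₁ (LeftOf-∷ l)
... | inj₂ (inj₁ (a∈ , b∈)) = inj₂ (inj₁ (there a∈ , b∈))
... | inj₂ (inj₂ r)          = inj₂ (inj₂ r)

LeftOf-reverse : ∀ w {a b} → LeftOf w a b → LeftOf (reverse w) b a
LeftOf-reverse []      ab = ⊥-elim (LeftOf-[] ab)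
LeftOf-reverse (x ∷ w) ab rewrite unfold-reverse x w with LeftOf-∷⁻ ab
... | inj₁ (refl , b∈w) = LeftOf-++ (reverse⁺ b∈w) (here refl)
... | inj₂ ab′          = LeftOf-++ˡ [ x ] (LeftOf-reverse w ab′)

LeftOf-reverse⁻ : ∀ w {a b} → LeftOf (reverse w) a b → LeftOf w b a
LeftOf-reverse⁻ w ab =
  subst (λ v → LeftOf v _ _) (reverse-involutive w) (LeftOf-reverse (reverse w) ab)

module _ {ℓ} {P : Pred ℕ ℓ} (P? : Decidable P) where

  LeftOf-filter⁺ : ∀ w {a b} → LeftOf w a b → P a → P b → LeftOf (filter P? w) a b
  LeftOf-filter⁺ []      ab _  _  = ⊥-elim (LeftOf-[] ab)
  LeftOf-filter⁺ (x ∷ w) ab pa pb with LeftOf-∷⁻ ab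
  ... | inj₁ (refl , b∈w) rewrite filter-accept P? {xs = w} pa = LeftOf-head (∈-filter⁺ P? b∈w pb)
  ... | inj₂ ab′ with P? x
  ...   | yes _ = LeftOf-∷ (LeftOf-filter⁺ w ab′ pa pb)
  ...   | no  _ = LeftOf-filter⁺ w ab′ pa pb

  LeftOf-filter⁻ : ∀ w {a b} → LeftOf (filter P? w) a b → LeftOf w a b
  LeftOf-filter⁻ []      ab = ⊥-elim (LeftOf-[] ab)
  LeftOf-filter⁻ (x ∷ w) ab with P? x
  ... | no  _ = LeftOf-∷ (LeftOf-filter⁻ w ab)
  ... | yes _ with LeftOf-∷⁻ ab
  ...   | inj₁ (refl , b∈) = LeftOf-head (proj₁ (∈-filter⁻ P? b∈))
  ...   | inj₂ ab′         = LeftOf-∷ (LeftOf-filter⁻ w ab′)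

LeftOf-total : ∀ w {a b} → a ∈ w → b ∈ w → a ≢ b → LeftOf w a b ⊎ LeftOf w b a
LeftOf-total (x ∷ w) (here refl) (here refl) a≢b = ⊥-elim (a≢b refl)
LeftOf-total (x ∷ w) (here refl) (there b∈) _   = inj₁ (LeftOf-head b∈)
LeftOf-total (x ∷ w) (there a∈) (here refl) _   = inj₂ (LeftOf-head a∈)
LeftOf-total (x ∷ w) (there a∈) (there b∈) a≢b with LeftOf-total w a∈ b∈ a≢b
... | inj₁ ab = inj₁ (LeftOf-∷ ab)
... | inj₂ ba = inj₂ (LeftOf-∷ ba)

LeftOf-asym : ∀ {w a b} → Unique w → LeftOf w a b → ¬ LeftOf w b a
LeftOf-asym {[]}    _ ab = ⊥-elim (LeftOf-[] ab)
LeftOf-asym {x ∷ w} (x∉w ∷ u) ab ba with LeftOf-∷⁻ ab | LeftOf-∷⁻ ba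
... | inj₁ (refl , b∈w) | inj₁ (refl , _)  = All.lookup x∉w b∈w refl
... | inj₁ (refl , _)   | inj₂ ba′         = All.lookup x∉w (proj₂ (LeftOf-∈ ba′)) refl
... | inj₂ ab′          | inj₁ (refl , _)  = All.lookup x∉w (proj₂ (LeftOf-∈ ab′)) refl
... | inj₂ ab′          | inj₂ ba′         = LeftOf-asym u ab′ ba′

markWord : (ℕ → Bool) → List ℕ → List ℕ
markWord M w = reverse (filterᵇ M w) ++ filterᵇ (λ i → not (M i)) w

mark-cases : ∀ b → T b ⊎ T (not b)
mark-cases true  = inj₁ tt
mark-cases false = inj₂ tt

mark-exclusive : ∀ {b} → T b → T (not b) → ⊥
mark-exclusive {true} _ ()

module _ (M : ℕ → Bool) (w : List ℕ) where

  private
    marked unmarked : List ℕ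
    marked   = filterᵇ M w
    unmarked = filterᵇ (λ i → not (M i)) w

    ∈-marked : ∀ {x} → x ∈ reverse marked → T (M x)
    ∈-marked x∈ = proj₂ (∈-filter⁻ (T? ∘ M) {xs = w} (reverse⁻ x∈))

    ∈-unmarked : ∀ {x} → x ∈ unmarked → T (not (M x))
    ∈-unmarked x∈ = proj₂ (∈-filter⁻ (T? ∘ (not ∘ M)) {xs = w} x∈)

  markWord-marked-first : ∀ {x y} → x ∈ w → y ∈ w → T (M x) → T (not (M y)) →
    LeftOf (markWord M w) x y
  markWord-marked-first x∈ y∈ mx uy =
    LeftOf-++ (reverse⁺ (∈-filter⁺ (T? ∘ M) x∈ mx)) (∈-filter⁺ (T? ∘ (not ∘ M)) y∈ uy)

  markWord-unmarked : ∀ {x y} → T (not (M x)) → T (not (M y)) →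
    LeftOf w x y → LeftOf (markWord M w) x y
  markWord-unmarked ux uy xy =
    LeftOf-++ʳ (reverse marked) (LeftOf-filter⁺ (T? ∘ (not ∘ M)) w xy ux uy)

  markWord-marked : ∀ {x y} → T (M x) → T (M y) →
    LeftOf w x y → LeftOf (markWord M w) y x
  markWord-marked mx my xy =
    LeftOf-++ˡ unmarked (LeftOf-reverse marked (LeftOf-filter⁺ (T? ∘ M) w xy mx my))

  markWord-unmarked⁻ : ∀ {x y} → T (not (M x)) → LeftOf (markWord M w) x y → LeftOf w x y
  markWord-unmarked⁻ ux xy with LeftOf-++⁻ (reverse marked) xy
  ... | inj₁ xy′             = ⊥-elim (mark-exclusive (∈-marked (proj₁ (LeftOf-∈ xy′))) ux)
  ... | inj₂ (inj₁ (x∈ , _)) = ⊥-elim (mark-exclusive (∈-marked x∈) ux)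
  ... | inj₂ (inj₂ xy′)      = LeftOf-filter⁻ (T? ∘ (not ∘ M)) w xy′

  markWord-marked⁻ : ∀ {x y} → T (M y) → LeftOf (markWord M w) x y → LeftOf w y x
  markWord-marked⁻ my xy with LeftOf-++⁻ (reverse marked) xy
  ... | inj₁ xy′             = LeftOf-filter⁻ (T? ∘ M) w (LeftOf-reverse⁻ marked xy′)
  ... | inj₂ (inj₁ (_ , y∈)) = ⊥-elim (mark-exclusive my (∈-unmarked y∈))
  ... | inj₂ (inj₂ xy′)      = ⊥-elim (mark-exclusive my (∈-unmarked (proj₂ (LeftOf-∈ xy′))))

-- The word-level theorem.  Letters a, b, c play the roles of i-1, i, i+1
-- at a peak: c is left of b, but b is not left of a.

peak-unmarked : ∀ M w {a b c} → T (not (M b)) → LeftOf w c b → ¬ LeftOf w b a →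
  LeftOf (markWord M w) c b × ¬ LeftOf (markWord M w) b a
peak-unmarked M w {b = b} {c} ub cb ¬ba =
  c-before-b (mark-cases (M c)) , ¬ba ∘ markWord-unmarked⁻ M w ub
  where
  c-before-b : T (M c) ⊎ T (not (M c)) → LeftOf (markWord M w) c b
  c-before-b (inj₁ mc) = markWord-marked-first M w (proj₁ (LeftOf-∈ cb)) (proj₂ (LeftOf-∈ cb)) mc ub
  c-before-b (inj₂ uc) = markWord-unmarked M w uc ub cb

peak-marked : ∀ M w {a b c} → Unique w → a ∈ w → a ≢ b → T (M b) →
  LeftOf w c b → ¬ LeftOf w b a →
  ¬ LeftOf (markWord M w) c b × LeftOf (markWord M w) b a
peak-marked M w {a} {b} u a∈w a≢b mb cb ¬ba =
  LeftOf-asym u cb ∘ markWord-marked⁻ M w mb , b-before-a (mark-cases (M a))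
  where
  b∈w : b ∈ w
  b∈w = proj₂ (LeftOf-∈ cb)
  a-before-b : LeftOf w a b
  a-before-b with LeftOf-total w a∈w b∈w a≢b
  ... | inj₁ ab = ab
  ... | inj₂ ba = ⊥-elim (¬ba ba)
  b-before-a : T (M a) ⊎ T (not (M a)) → LeftOf (markWord M w) b a
  b-before-a (inj₁ ma) = markWord-marked M w ma mb a-before-b
  b-before-a (inj₂ ua) = markWord-marked-first M w b∈w a∈w mb ua

peak⇒spike : ∀ n w M → Unique w → (∀ j → 1 ≤ j → j ≤ n → j ∈ w) →
  ∀ i → Peak (DesW n w) i → Spike (DesW n (markWord M w)) i
peak⇒spike n w M u complete (suc h) (2≤i , (1≤i , i<n , cb) , ¬des-h) =
  2≤i , spike (mark-cases (M (suc h)))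
  where
  h≥1 : 1 ≤ h
  h≥1 = ≤-pred 2≤i
  h<n : h < n
  h<n = <⇒≤ i<n
  ¬ba : ¬ LeftOf w (suc h) h
  ¬ba ba = ¬des-h (h≥1 , h<n , ba)
  spike : T (M (suc h)) ⊎ T (not (M (suc h))) →
    (DesW n (markWord M w) (suc h) × ¬ DesW n (markWord M w) h) ⊎
    (¬ DesW n (markWord M w) (suc h) × DesW n (markWord M w) h)
  spike (inj₂ ub) with cb′ , ¬ba′ ← peak-unmarked M w ub cb ¬ba =
    inj₁ ((1≤i , i<n , cb′) , λ (_ , _ , ba′) → ¬ba′ ba′)
  spike (inj₁ mb) with ¬cb′ , ba′ ← peak-marked M w u (complete h h≥1 (<⇒≤ h<n)) (1+n≢n ∘ sym) mb cb ¬ba =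
    inj₂ ((λ (_ , _ , cb′) → ¬cb′ cb′) , (h≥1 , h<n , ba′))

labels-unique : ∀ m → Unique (labels m)
labels-unique m = Unique.map⁺ suc-injective (Unique.upTo⁺ m)

∈-labels : ∀ {j m} → 1 ≤ j → j ≤ m → j ∈ labels m
∈-labels {suc j} (s≤s z≤n) j≤m = ∈-map⁺ suc (∈-upTo⁺ j≤m)

concatMap-unique : ∀ {A : Set} (f : A → List ℕ) {xs} → Unique xs →
  (∀ x → Unique (f x)) → (∀ {x x′ y} → y ∈ f x → y ∈ f x′ → x ≡ x′) →
  Unique (concatMap f xs)
concatMap-unique f {[]}     []          _      _      = []
concatMap-unique f {x ∷ xs} (x∉xs ∷ u) f-uniq f-fibre =
  Unique.++⁺ (f-uniq x) (concatMap-unique f u f-uniq f-fibre) disjoint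
  where
  disjoint : ∀ {y} → ¬ (y ∈ f x × y ∈ concatMap f xs)
  disjoint (y∈fx , y∈rest) with x′ , x′∈xs , y∈fx′ ← find (∈-concatMap⁻ f y∈rest) =
    All.lookup x∉xs x′∈xs (f-fibre y∈fx y∈fx′)

reverse-unique : ∀ xs → Unique xs → Unique (reverse xs)
reverse-unique xs = Unique-resp-↭ (↭-sym (↭-reverse xs))

nthPart-≤-first : ∀ {p} → Linked _>_ p → ∀ j → nthPart p j ≤ nthPart p 0
nthPart-≤-first {[]}         _          _       = z≤n
nthPart-≤-first {x ∷ xs}     _          zero    = ≤-refl
nthPart-≤-first {x ∷ []}     _          (suc j) = z≤n
nthPart-≤-first {x ∷ y ∷ ys} (x>y ∷ ys↓) (suc j) = ≤-trans (nthPart-≤-first ys↓ j) (<⇒≤ x>y)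

nthPart-index : ∀ p j → 1 ≤ nthPart p j → j < length p
nthPart-index (x ∷ xs) zero    _  = s≤s z≤n
nthPart-index (x ∷ xs) (suc j) pj = s≤s (nthPart-index xs j pj)

-- The shifted diagram of a strict partition p lies in rows 1 .. ℓ(p)
-- and columns 1 .. ℓ(p) + p₁, the grid scanned by the reading word.
InShifted-bounds : ∀ {p} → Linked _>_ p → ∀ {r c} → InShifted p (r , c) →
  (1 ≤ r × r ≤ length p) × (1 ≤ c × c ≤ length p + part p 1)
InShifted-bounds {p} p↓ {suc r} {c} (r≥1 , r≤c , c<) =
  (r≥1 , row-bound) , (≤-trans r≥1 r≤c , <⇒≤ (<-≤-trans c< (+-mono-≤ row-bound (nthPart-≤-first p↓ r))))
  where
  part-pos : 1 ≤ nthPart p r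
  part-pos = +-cancelˡ-< (suc r) 0 (nthPart p r)
    (subst (_< suc r + nthPart p r) (sym (+-identityʳ (suc r))) (≤-<-trans r≤c c<))
  row-bound : suc r ≤ length p
  row-bound = nthPart-index p r part-pos

module _ {k n sh} (T : SSRT k n sh) where

  shape-⊆ : ∀ {i j} → i ≤ j → j ≤ n → shape T i ⊆sh shape T j
  shape-⊆ {j = zero}  z≤n _ = λ _ x∈ → x∈
  shape-⊆ {j = suc j} i≤j j<n with m≤n⇒m<n∨m≡n i≤j
  ... | inj₂ refl          = λ _ x∈ → x∈
  ... | inj₁ (s≤s i≤j′) = λ x x∈ → ribbon-grows x (shape-⊆ i≤j′ (<⇒≤ j<n) x x∈)
    where
    ribbon-grows : shape T j ⊆sh shape T (suc j)
    ribbon-grows = proj₁ (proj₂ (ribbon T (suc j) (s≤s z≤n) j<n))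

  head-bounds : ∀ j → 1 ≤ j → j ≤ n →
    (1 ≤ row (head T j) × row (head T j) ≤ length sh) ×
    (1 ≤ col (head T j) × col (head T j) ≤ length sh + part sh 1)
  head-bounds j j≥1 j≤n = InShifted-bounds (proj₂ sh-strict) head-in-sh
    where
    sh-strict : IsStrictPartition sh
    sh-strict = subst IsStrictPartition (shape-top T) (shape-sp T n ≤-refl)
    head-in-sh : InShifted sh (head T j)
    head-in-sh = subst (λ p → InShifted p (head T j)) (shape-top T)
      (shape-⊆ j≤n ≤-refl (head T j) (proj₁ (proj₁ (head-spec T j j≥1 j≤n))))

  cellWord : ℕ → ℕ → List ℕ
  cellWord r c = filterᵇ (λ i → ⌊ head T i ≟c (r , c) ⌋) (labels n)

  width : ℕ
  width = length sh + part sh 1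

  rowWord : ℕ → List ℕ
  rowWord r = concatMap (cellWord r) (labels width)

  ∈-cellWord⁻ : ∀ {i r c} → i ∈ cellWord r c → head T i ≡ (r , c)
  ∈-cellWord⁻ {r = r} {c} i∈ =
    toWitness (proj₂ (∈-filter⁻ (T? ∘ λ i → ⌊ head T i ≟c (r , c) ⌋) {xs = labels n} i∈))

  ∈-rowWord⁻ : ∀ {i r} → i ∈ rowWord r → row (head T i) ≡ r
  ∈-rowWord⁻ {r = r} i∈
    with c , i∈c ← satisfied (∈-concatMap⁻ (cellWord r) {xs = labels width} i∈) =
    cong row (∈-cellWord⁻ i∈c)

  readingWord-unique : Unique (readingWord T)
  readingWord-unique =
    concatMap-unique rowWord (reverse-unique (labels (length sh)) (labels-unique (length sh)))
      (λ r → concatMap-unique (cellWord r) (labels-unique width)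
               (λ c → Unique.filter⁺ _ (labels-unique n))
               (λ i∈c i∈c′ → cong col (trans (sym (∈-cellWord⁻ i∈c)) (∈-cellWord⁻ i∈c′))))
      (λ i∈r i∈r′ → trans (sym (∈-rowWord⁻ i∈r)) (∈-rowWord⁻ i∈r′))

  readingWord-complete : ∀ j → 1 ≤ j → j ≤ n → j ∈ readingWord T
  readingWord-complete j j≥1 j≤n
    with (r≥1 , r≤length) , (c≥1 , c≤width) ← head-bounds j j≥1 j≤n =
    ∈-concatMap⁺ rowWord (lose (reverse⁺ (∈-labels r≥1 r≤length)) (∈-concatMap⁺ (cellWord r)
      (lose (∈-labels c≥1 c≤width) (∈-filter⁺ (T? ∘ λ i → ⌊ head T i ≟c (r , c) ⌋) (∈-labels j≥1 j≤n)
        (fromWitness refl)))))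
    where
    r c : ℕ
    r = row (head T j)
    c = col (head T j)

mainTheorem18 : (k n : ℕ) → 1 ≤ k → (sh : List ℕ) → (T : SSRT k n sh) →
    (M : ℕ → Bool) → ∀ i → Peak (Des T) i → Spike (DesMarked T M) i
mainTheorem18 k n _ sh T M =
  peak⇒spike n (readingWord T) M (readingWord-unique T) (readingWord-complete T)
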